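{- Let $(G,k)$ be an instance of Vertex Cover, let $a,b$ be two adjacent vertices of $G$, and let $C=N(a)\cap N(b)$. Let $G'$ be obtained from $G$ by creating two new vertices $v,c$, adding the edges $\{v,a\},\{v,b\},\{v,c\}$, deleting all edges between $a$ and $C$ and between $b$ and $C$, and adding all edges between $c$ and $C$. Then $(G,k)$ and $(G',k+1)$ are equivalent.
   Context: Vertex Cover: given an undirected simple graph $G=(V,E)$ and an integer $k$, decide whether there is $S\subseteq V$ with $|S|\le k$ such that every edge has an endpoint in $S$. Two instances are equivalent if both are yes-instances or both are no-instances. $N(x)$ is the open neighborhood of $x$. -}

module Defs where

open import Data.Nat using (ℕ; suc; _≤_)
open import Data.Fin using (Fin; zero; suc)
open import Data.Fin.Subset using (Subset; _∈_; ∣_∣)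
open import Data.Bool using (Bool; true; false; _∧_; _∨_; not)
open import Data.Sum using (_⊎_)
open import Data.Product using (Σ; _×_)
open import Relation.Binary.PropositionalEquality using (_≡_)

record Graph (n : ℕ) : Set where
  field
    adj    : Fin n → Fin n → Bool
    sym    : ∀ x y → adj x y ≡ adj y x
    irrefl : ∀ x → adj x x ≡ false
open Graph public

Edge : ∀ {n} → Graph n → Fin n → Fin n → Set
Edge G x y = adj G x y ≡ true

IsVertexCover : ∀ {n} → Graph n → Subset n → Set
IsVertexCover G S = ∀ x y → Edge G x y → (x ∈ S) ⊎ (y ∈ S)

HasVC : ∀ {n} → Graph n → ℕ → Set
HasVC {n} G k = Σ (Subset n) λ S → (∣ S ∣ ≤ k) × IsVertexCover G S

inC : ∀ {n} → Graph n → Fin n → Fin n → Fin n → Bool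
inC G a b x = adj G a x ∧ adj G b x

-- New vertex set Fin (2 + n): zero is v, suc zero is c, suc (suc x) is old vertex x.
isA-or-B : ∀ {n} → (Fin n → Fin n → Bool) → Fin n → Fin n → Fin n → Bool
isA-or-B eqb a b x = eqb x a ∨ eqb x b

module _ where
  open import Data.Fin using (_≟_)
  open import Relation.Nullary.Decidable using (⌊_⌋)

  eqF : ∀ {n} → Fin n → Fin n → Bool
  eqF x y = ⌊ x ≟ y ⌋

  deleted : ∀ {n} → Graph n → Fin n → Fin n → Fin n → Fin n → Bool
  deleted G a b x y =
    (isA-or-B eqF a b x ∧ inC G a b y) ∨ (isA-or-B eqF a b y ∧ inC G a b x)

  adj' : ∀ {n} → Graph n → Fin n → Fin n → Fin (suc (suc n)) → Fin (suc (suc n)) → Bool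
  adj' G a b zero zero = false
  adj' G a b zero (suc zero) = true
  adj' G a b zero (suc (suc y)) = isA-or-B eqF a b y
  adj' G a b (suc zero) zero = true
  adj' G a b (suc zero) (suc zero) = false
  adj' G a b (suc zero) (suc (suc y)) = inC G a b y
  adj' G a b (suc (suc x)) zero = isA-or-B eqF a b x
  adj' G a b (suc (suc x)) (suc zero) = inC G a b x
  adj' G a b (suc (suc x)) (suc (suc y)) = adj G x y ∧ not (deleted G a b x y)

  open import Data.Bool.Properties using (∧-comm; ∨-comm)
  open import Relation.Binary.PropositionalEquality using (refl; cong₂; cong)

  private
    deleted-sym : ∀ {n} (G : Graph n) a b x y → deleted G a b x y ≡ deleted G a b y x
    deleted-sym G a b x y = ∨-comm (isA-or-B eqF a b x ∧ inC G a b y) (isA-or-B eqF a b y ∧ inC G a b x)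

    ab-irr : ∀ {n} (G : Graph n) a b x → (adj G x x ∧ not (deleted G a b x x)) ≡ false
    ab-irr G a b x rewrite irrefl G x = refl

  adj'-sym : ∀ {n} (G : Graph n) a b x y → adj' G a b x y ≡ adj' G a b y x
  adj'-sym G a b zero zero = refl
  adj'-sym G a b zero (suc zero) = refl
  adj'-sym G a b zero (suc (suc y)) = refl
  adj'-sym G a b (suc zero) zero = refl
  adj'-sym G a b (suc zero) (suc zero) = refl
  adj'-sym G a b (suc zero) (suc (suc y)) = refl
  adj'-sym G a b (suc (suc x)) zero = refl
  adj'-sym G a b (suc (suc x)) (suc zero) = refl
  adj'-sym G a b (suc (suc x)) (suc (suc y)) =
    cong₂ _∧_ (sym G x y) (cong not (deleted-sym G a b x y))

  adj'-irr : ∀ {n} (G : Graph n) a b x → adj' G a b x x ≡ false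
  adj'-irr G a b zero = refl
  adj'-irr G a b (suc zero) = refl
  adj'-irr G a b (suc (suc x)) = ab-irr G a b x

  G′ : ∀ {n} → Graph n → Fin n → Fin n → Graph (suc (suc n))
  G′ G a b = record { adj = adj' G a b ; sym = adj'-sym G a b ; irrefl = adj'-irr G a b }

-- A cover of G′ must contain v or c, since vc is an edge. If it contains c but not v, then it
-- contains a and b; if v but not c, then it contains C. Either way its restriction to G also
-- covers the deleted edges, each of which joins {a, b} to C. If it contains both v and c, the
-- kept edge ab puts a or b into the rest, and adding the other endpoint costs one vertex,
-- which the surplus vertex pays for. Conversely, a cover of G extends by c when it contains
-- a and b, and by v otherwise: missing a or b forces it to contain all of C.
module Submission where

open import Defs
open import Data.Nat using (ℕ; suc; _≤_; s≤s)
open import Data.Nat.Properties using (≤-refl; ≤-trans; n≤1+n)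
open import Data.Fin using (Fin; zero; suc; _≟_)
open import Data.Fin.Subset using (Subset; _∈_; _∉_; _⊆_; ∣_∣; inside; outside)
open import Data.Fin.Subset.Properties using (_∈?_; drop-there)
open import Data.Vec using (_∷_)
open import Data.Vec.Base using (here; there)
open import Data.Bool using (Bool; true; false; _∧_; _∨_)
open import Data.Bool.Properties using (∧-zeroʳ; ∨-zeroʳ; ∧-conicalˡ; ∧-conicalʳ)
open import Data.Sum using (_⊎_; inj₁; inj₂) renaming (map to ⊎-map)
open import Data.Product using (Σ; _×_; _,_)
open import Data.Empty using (⊥-elim)
open import Function using (_∘_; id)
open import Function.Bundles using (_⇔_; mk⇔)
open import Relation.Nullary using (¬_; yes; no)
open import Relation.Nullary.Decidable using (_×-dec_)
open import Relation.Binary.PropositionalEquality using (_≡_; refl)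

∨≡true⁻ : ∀ {p q} → p ∨ q ≡ true → p ≡ true ⊎ q ≡ true
∨≡true⁻ {true}  _ = inj₁ refl
∨≡true⁻ {false} q = inj₂ q

∧≡true⁻ : ∀ {p q} → p ∧ q ≡ true → p ≡ true × q ≡ true
∧≡true⁻ {p} {q} h = ∧-conicalˡ p q h , ∧-conicalʳ p q h

eqF-refl : ∀ {n} (x : Fin n) → eqF x x ≡ true
eqF-refl x with x ≟ x
... | yes _  = refl
... | no x≢x = ⊥-elim (x≢x refl)

eqF≡true⇒≡ : ∀ {n} {x y : Fin n} → eqF x y ≡ true → x ≡ y
eqF≡true⇒≡ {x = x} {y} h with x ≟ y
... | yes x≡y = x≡y

insert : ∀ {n} → Fin n → Subset n → Subset n
insert zero    (_ ∷ p) = inside ∷ p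
insert (suc x) (s ∷ p) = s ∷ insert x p

x∈insert : ∀ {n} (x : Fin n) (p : Subset n) → x ∈ insert x p
x∈insert zero    (_ ∷ p) = here
x∈insert (suc x) (_ ∷ p) = there (x∈insert x p)

p⊆insert : ∀ {n} (x : Fin n) (p : Subset n) → p ⊆ insert x p
p⊆insert zero    (_ ∷ p) here      = here
p⊆insert zero    (_ ∷ p) (there y) = there y
p⊆insert (suc x) (_ ∷ p) here      = here
p⊆insert (suc x) (_ ∷ p) (there y) = there (p⊆insert x p y)

∣insert∣≤1+∣p∣ : ∀ {n} (x : Fin n) (p : Subset n) → ∣ insert x p ∣ ≤ suc ∣ p ∣
∣insert∣≤1+∣p∣ zero    (true  ∷ p) = n≤1+n _
∣insert∣≤1+∣p∣ zero    (false ∷ p) = ≤-refl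
∣insert∣≤1+∣p∣ (suc x) (true  ∷ p) = s≤s (∣insert∣≤1+∣p∣ x p)
∣insert∣≤1+∣p∣ (suc x) (false ∷ p) = ∣insert∣≤1+∣p∣ x p

completePair : ∀ {n} {x y : Fin n} (p : Subset n) → x ∈ p ⊎ y ∈ p →
               Σ (Subset n) λ q → p ⊆ q × ∣ q ∣ ≤ suc ∣ p ∣ × x ∈ q × y ∈ q
completePair {y = y} p (inj₁ x∈p) =
  insert y p , p⊆insert y p , ∣insert∣≤1+∣p∣ y p , p⊆insert y p x∈p , x∈insert y p
completePair {x = x} p (inj₂ y∈p) =
  insert x p , p⊆insert x p , ∣insert∣≤1+∣p∣ x p , x∈insert x p , p⊆insert x p y∈p

cover-∉⇒∈ : ∀ {n} (G : Graph n) {S : Subset n} {x y : Fin n} →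
            IsVertexCover G S → Edge G x y → y ∉ S → x ∈ S
cover-∉⇒∈ G {x = x} {y} cov e y∉S with cov x y e
... | inj₁ x∈S = x∈S
... | inj₂ y∈S = ⊥-elim (y∉S y∈S)

pattern v = zero
pattern c = suc zero
pattern old x = suc (suc x)

drop-old : ∀ {n} {s t : Bool} {p : Subset n} {x} → old x ∈ (s ∷ t ∷ p) → x ∈ p
drop-old = drop-there ∘ drop-there

module _ {n} (G : Graph n) (a b : Fin n) where

  ContainsAB : Subset n → Set
  ContainsAB T = a ∈ T × b ∈ T

  ContainsC : Subset n → Set
  ContainsC T = ∀ y → inC G a b y ≡ true → y ∈ T

  isA-or-B-a : isA-or-B eqF a b a ≡ true
  isA-or-B-a rewrite eqF-refl a = refl

  isA-or-B-b : isA-or-B eqF a b b ≡ true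
  isA-or-B-b rewrite eqF-refl b = ∨-zeroʳ (eqF b a)

  ContainsAB⇒isA-or-B⊆ : ∀ {T x} → ContainsAB T → isA-or-B eqF a b x ≡ true → x ∈ T
  ContainsAB⇒isA-or-B⊆ {x = x} (a∈T , b∈T) h with ∨≡true⁻ {eqF x a} h
  ... | inj₁ x≟a rewrite eqF≡true⇒≡ x≟a = a∈T
  ... | inj₂ x≟b rewrite eqF≡true⇒≡ x≟b = b∈T

  deleted⁻ : ∀ x y → deleted G a b x y ≡ true →
             (isA-or-B eqF a b x ≡ true × inC G a b y ≡ true) ⊎
             (isA-or-B eqF a b y ≡ true × inC G a b x ≡ true)
  deleted⁻ x y h = ⊎-map ∧≡true⁻ ∧≡true⁻ (∨≡true⁻ h)

  deleted-covered : ∀ {T} → ContainsAB T ⊎ ContainsC T →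
                    ∀ x y → deleted G a b x y ≡ true → x ∈ T ⊎ y ∈ T
  deleted-covered (inj₁ ab) x y d with deleted⁻ x y d
  ... | inj₁ (x∈AB , _) = inj₁ (ContainsAB⇒isA-or-B⊆ ab x∈AB)
  ... | inj₂ (y∈AB , _) = inj₂ (ContainsAB⇒isA-or-B⊆ ab y∈AB)
  deleted-covered (inj₂ C⊆T) x y d with deleted⁻ x y d
  ... | inj₁ (_ , y∈C) = inj₂ (C⊆T y y∈C)
  ... | inj₂ (_ , x∈C) = inj₁ (C⊆T x x∈C)

  kept-edge : ∀ {x y} → Edge G x y → deleted G a b x y ≡ false →
              Edge (G′ G a b) (old x) (old y)
  kept-edge e d rewrite e | d = refl

  old-edge : ∀ {x y} → Edge (G′ G a b) (old x) (old y) → Edge G x y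
  old-edge {x} {y} = ∧-conicalˡ (adj G x y) _

  ab-not-deleted : deleted G a b a b ≡ false
  ab-not-deleted rewrite irrefl G a | irrefl G b | ∧-zeroʳ (adj G a b)
                       | ∧-zeroʳ (isA-or-B eqF a b a) | ∧-zeroʳ (isA-or-B eqF a b b) = refl

  old-covered : ∀ {S s t x y} → IsVertexCover G S → Edge (G′ G a b) (old x) (old y) →
                old x ∈ (s ∷ t ∷ S) ⊎ old y ∈ (s ∷ t ∷ S)
  old-covered {x = x} {y} cov e = ⊎-map (there ∘ there) (there ∘ there) (cov x y (old-edge e))

  cover-with-c : ∀ {S} → IsVertexCover G S → ContainsAB S →
                 IsVertexCover (G′ G a b) (outside ∷ inside ∷ S)
  cover-with-c cov ab v       c       _ = inj₂ (there here)
  cover-with-c cov ab v       (old y) e = inj₂ (there (there (ContainsAB⇒isA-or-B⊆ ab e)))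
  cover-with-c cov ab c       v       _ = inj₁ (there here)
  cover-with-c cov ab c       (old y) _ = inj₁ (there here)
  cover-with-c cov ab (old x) v       e = inj₁ (there (there (ContainsAB⇒isA-or-B⊆ ab e)))
  cover-with-c cov ab (old x) c       _ = inj₂ (there here)
  cover-with-c cov ab (old x) (old y) e = old-covered cov e

  cover-with-v : ∀ {S} → IsVertexCover G S → ContainsC S →
                 IsVertexCover (G′ G a b) (inside ∷ outside ∷ S)
  cover-with-v cov C⊆S v       _       _ = inj₁ here
  cover-with-v cov C⊆S c       v       _ = inj₂ here
  cover-with-v cov C⊆S c       (old y) e = inj₂ (there (there (C⊆S y e)))
  cover-with-v cov C⊆S (old x) v       _ = inj₂ here
  cover-with-v cov C⊆S (old x) c       e = inj₁ (there (there (C⊆S x e)))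
  cover-with-v cov C⊆S (old x) (old y) e = old-covered cov e

  restrict-cover : ∀ {s t S T} → IsVertexCover (G′ G a b) (s ∷ t ∷ S) → S ⊆ T →
                   ContainsAB T ⊎ ContainsC T → IsVertexCover G T
  restrict-cover cov S⊆T hT x y e with deleted G a b x y in d
  ... | true  = deleted-covered hT x y d
  ... | false = ⊎-map (S⊆T ∘ drop-old) (S⊆T ∘ drop-old) (cov (old x) (old y) (kept-edge e d))

  ¬ContainsAB⇒ContainsC : ∀ {S} → IsVertexCover G S → ¬ ContainsAB S → ContainsC S
  ¬ContainsAB⇒ContainsC {S} cov ¬ab y y∈C with y ∈? S
  ... | yes y∈S = y∈S
  ... | no  y∉S with ay , by ← ∧≡true⁻ {adj G a y} y∈C =
    ⊥-elim (¬ab (cover-∉⇒∈ G cov ay y∉S , cover-∉⇒∈ G cov by y∉S))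

  a-or-b-covered : ∀ {s t S} → IsVertexCover (G′ G a b) (s ∷ t ∷ S) → Edge G a b →
                   a ∈ S ⊎ b ∈ S
  a-or-b-covered cov ab =
    ⊎-map drop-old drop-old (cov (old a) (old b) (kept-edge ab ab-not-deleted))

  extend-HasVC : ∀ {k} → HasVC G k → HasVC (G′ G a b) (suc k)
  extend-HasVC (S , ∣S∣≤k , cov) with (a ∈? S) ×-dec (b ∈? S)
  ... | yes ab  = outside ∷ inside ∷ S , s≤s ∣S∣≤k , cover-with-c cov ab
  ... | no  ¬ab =
    inside ∷ outside ∷ S , s≤s ∣S∣≤k , cover-with-v cov (¬ContainsAB⇒ContainsC cov ¬ab)

  restrict-HasVC : ∀ {k} → Edge G a b → HasVC (G′ G a b) (suc k) → HasVC G k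
  restrict-HasVC _ (outside ∷ outside ∷ S , _ , cov) with cov v c refl
  ... | inj₁ ()
  ... | inj₂ (there ())
  restrict-HasVC _ (outside ∷ inside ∷ S , s≤s ∣S∣≤k , cov) =
    S , ∣S∣≤k , restrict-cover cov id (inj₁ (forced a isA-or-B-a , forced b isA-or-B-b))
    where
    forced : ∀ x → Edge (G′ G a b) (old x) v → x ∈ S
    forced x e = drop-old (cover-∉⇒∈ (G′ G a b) {y = v} cov e λ ())
  restrict-HasVC _ (inside ∷ outside ∷ S , s≤s ∣S∣≤k , cov) =
    S , ∣S∣≤k , restrict-cover cov id (inj₂ forced)
    where
    forced : ContainsC S
    forced y e = drop-old (cover-∉⇒∈ (G′ G a b) {y = c} cov e λ { (there ()) })
  restrict-HasVC ab (inside ∷ inside ∷ S , s≤s ∣S∣<k , cov)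
    with T , S⊆T , ∣T∣≤1+∣S∣ , a∈T , b∈T ← completePair S (a-or-b-covered cov ab) =
    T , ≤-trans ∣T∣≤1+∣S∣ ∣S∣<k , restrict-cover cov S⊆T (inj₁ (a∈T , b∈T))

lemma7 : ∀ {n} (G : Graph n) (k : ℕ) (a b : Fin n) → Edge G a b →
    HasVC G k ⇔ HasVC (G′ G a b) (suc k)
lemma7 G k a b ab = mk⇔ (extend-HasVC G a b) (restrict-HasVC G a b ab)
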